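{- For every typing context $\Gamma$, store terms $s,t$ and store type $\sigma$: if $\Gamma\vdash s:\sigma$ and $\vdash s=t$, then $\Gamma\vdash t:\sigma$.
   Context: Fix a countably infinite set $\mathbf{L}$ of locations. Values $V,W,U ::= x\mid\lambda x.M$ where $M$ ranges over computations $[V]\mid M\star V\mid\mathit{get}_\ell(\lambda x.M)\mid\mathit{set}_\ell(V,M)$. Store terms $s,t ::= \mathrm{emp} \mid \mathrm{upd}_\ell(u,s)$, lookup terms $u ::= V \mid \mathrm{lkp}_\ell(s)$ (only when $\ell\in\mathrm{dom}(s)$; $\mathrm{dom}(\mathrm{emp})=\emptyset$, $\mathrm{dom}(\mathrm{upd}_\ell(u,s))=\{\ell\}\cup\mathrm{dom}(s)$). $\vdash a=b$ means derivable in equational logic (reflexivity, symmetry, transitivity, congruence) from: $\mathrm{lkp}_\ell(\mathrm{upd}_\ell(u,s))=u$; $\mathrm{lkp}_\ell(\mathrm{upd}_{\ell'}(u,s))=\mathrm{lkp}_\ell(s)$ ($\ell\ne\ell'$); $\mathrm{upd}_\ell(\mathrm{lkp}_\ell(s),s)=s$; $\mathrm{upd}_\ell(U,\mathrm{upd}_\ell(W,s))=\mathrm{upd}_\ell(U,s)$; $\mathrm{upd}_\ell(U,\mathrm{upd}_{\ell'}(W,s))=\mathrm{upd}_{\ell'}(W,\mathrm{upd}_\ell(U,s))$ ($\ell\ne\ell'$). Types. Value types $\delta ::= \delta\to\tau \mid \delta\wedge\delta \mid \omega_D$; store types $\sigma ::= \langle \ell:\delta\rangle \mid \sigma\wedge\sigma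 \mid \omega_S$; computation types $\kappa ::= \delta\times\sigma \mid \kappa\wedge\kappa\mid\omega_C$; configuration types $\tau ::= \sigma\to\kappa \mid \tau\wedge\tau \mid \omega_T$. For each sort $A$, $\le_A$ is the least preorder with $\varphi\le\omega_A$, $\varphi\wedge\psi\le\varphi$, $\varphi\wedge\psi\le\psi$, $\varphi\le\varphi\wedge\varphi$, monotonicity of $\wedge$, and: $\omega_D\le\omega_D\to\omega_T$; $(\delta\to\tau)\wedge(\delta\to\tau')\le\delta\to(\tau\wedge\tau')$; $\langle\ell:\delta\rangle\wedge\langle\ell:\delta'\rangle\le\langle\ell:\delta\wedge\delta'\rangle$; $\omega_C\le\omega_D\times\omega_S$; $(\delta\times\sigma)\wedge(\delta'\times\sigma')\le(\delta\wedge\delta')\times(\sigma\wedge\sigma')$; $\omega_T\le\omega_S\to\omega_C$; $(\sigma\to\kappa)\wedge(\sigma\to\kappa')\le\sigma\to(\kappa\wedge\kappa')$; arrows contravariant/covariant; $\times$, $\langle\ell:\cdot\rangle$ covariant. $\mathrm{dom}(\langle\ell:\delta\rangle)=\{\ell\}$, $\mathrm{dom}(\sigma\wedge\sigma')=\mathrm{dom}(\sigma)\cup\mathrm{dom}(\sigma')$, $\mathrm{dom}(\omega_S)=\emptyset$. Type system. Contexts $\Gamma$ map finitely many variables to value types ($\Gamma,x:\delta$ requires $x\notin\mathrm{dom}(\Gamma)$). Rules: $\Gamma\vdash Q:\omega_A$ for $Q$ of the corresponding sort; intersection introduction; subsumption; $\Gamma,x:\delta\vdash x:\delta$; $\Gamma,x:\delta\vdash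 M:\tau\Rightarrow\Gamma\vdash\lambda x.M:\delta\to\tau$; $\Gamma\vdash V:\delta\Rightarrow\Gamma\vdash[V]:\sigma\to\delta\times\sigma$; $\Gamma\vdash M:\sigma\to\delta'\times\sigma'$, $\Gamma\vdash V:\delta'\to\sigma'\to\delta''\times\sigma''\Rightarrow\Gamma\vdash M\star V:\sigma\to\delta''\times\sigma''$; $\Gamma,x:\delta\vdash M:\sigma\to\kappa\Rightarrow\Gamma\vdash\mathit{get}_\ell(\lambda x.M):(\langle\ell:\delta\rangle\wedge\sigma)\to\kappa$; $\Gamma\vdash V:\delta$, $\Gamma\vdash M:(\langle\ell:\delta\rangle\wedge\sigma)\to\kappa$, $\ell\notin\mathrm{dom}(\sigma)\Rightarrow\Gamma\vdash\mathit{set}_\ell(V,M):\sigma\to\kappa$; $\Gamma\vdash V:\delta\Rightarrow\Gamma\vdash\mathrm{upd}_\ell(V,s):\langle\ell:\delta\rangle$; $\Gamma\vdash s:\langle\ell':\delta\rangle$, $\ell\ne\ell'\Rightarrow\Gamma\vdash\mathrm{upd}_\ell(V,s):\langle\ell':\delta\rangle$; $\Gamma\vdash s:\langle\ell:\delta\rangle\Rightarrow\Gamma\vdash\mathrm{lkp}_\ell(s):\delta$. -}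

module Defs where

open import Data.Nat using (ℕ)
open import Data.List using (List; []; _∷_)
open import Data.Empty using (⊥)
open import Data.Sum using (_⊎_)
open import Relation.Binary.PropositionalEquality using (_≡_; _≢_)
open import Relation.Nullary using (¬_)

Loc : Set
Loc = ℕ

-- Syntax (variables as de Bruijn indices; binders: λx.M and get_ℓ(λx.M))

mutual
  data Val : Set where
    var : ℕ → Val
    lam : Comp → Val

  data Comp : Set where
    ret  : Val → Comp
    bind : Comp → Val → Comp
    get  : Loc → Comp → Comp
    set  : Loc → Val → Comp → Comp

-- Store terms and lookup terms (lkp_ℓ(s) only when ℓ ∈ dom(s)),
-- by induction-recursion with the domain predicate.
mutual
  data Store : Set where
    emp : Store
    upd : Loc → Lookup → Store → Store

  data Lookup : Set where
    val : Val → Lookup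
    lkp : (ℓ : Loc) (s : Store) → ℓ ∈dom s → Lookup

  _∈dom_ : Loc → Store → Set
  ℓ ∈dom emp         = ⊥
  ℓ ∈dom upd ℓ' u s  = (ℓ ≡ ℓ') ⊎ (ℓ ∈dom s)

mutual
  data _≈ˢ_ : Store → Store → Set where
    reflˢ  : ∀ {s} → s ≈ˢ s
    symˢ   : ∀ {s t} → s ≈ˢ t → t ≈ˢ s
    transˢ : ∀ {s t r} → s ≈ˢ t → t ≈ˢ r → s ≈ˢ r
    cong-upd : ∀ {ℓ u u' s s'} → u ≈ˡ u' → s ≈ˢ s' → upd ℓ u s ≈ˢ upd ℓ u' s'
    ax-upd-lkp : ∀ {ℓ s} (p : ℓ ∈dom s) → upd ℓ (lkp ℓ s p) s ≈ˢ s
    ax-upd-upd : ∀ {ℓ U W s} → upd ℓ (val U) (upd ℓ (val W) s) ≈ˢ upd ℓ (val U) s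
    ax-upd-comm : ∀ {ℓ ℓ' U W s} → ℓ ≢ ℓ' →
      upd ℓ (val U) (upd ℓ' (val W) s) ≈ˢ upd ℓ' (val W) (upd ℓ (val U) s)

  data _≈ˡ_ : Lookup → Lookup → Set where
    reflˡ  : ∀ {u} → u ≈ˡ u
    symˡ   : ∀ {u v} → u ≈ˡ v → v ≈ˡ u
    transˡ : ∀ {u v w} → u ≈ˡ v → v ≈ˡ w → u ≈ˡ w
    cong-lkp : ∀ {ℓ s s'} (p : ℓ ∈dom s) (p' : ℓ ∈dom s') → s ≈ˢ s' → lkp ℓ s p ≈ˡ lkp ℓ s' p'
    ax-lkp-upd : ∀ {ℓ u s} (p : ℓ ∈dom upd ℓ u s) → lkp ℓ (upd ℓ u s) p ≈ˡ u
    ax-lkp-upd' : ∀ {ℓ ℓ' u s} → ℓ ≢ ℓ' → (p : ℓ ∈dom upd ℓ' u s) (q : ℓ ∈dom s) →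
      lkp ℓ (upd ℓ' u s) p ≈ˡ lkp ℓ s q

infixr 7 _⇒ᵈ_ _⇒ᵗ_
infixl 8 _∧ᵈ_ _∧ˢ_ _∧ᶜ_ _∧ᵗ_
infix 9 _⊗_

mutual
  data VTy : Set where
    _⇒ᵈ_ : VTy → CfgTy → VTy
    _∧ᵈ_ : VTy → VTy → VTy
    ωᵈ   : VTy

  data STy : Set where
    ⟨_∶_⟩ : Loc → VTy → STy
    _∧ˢ_  : STy → STy → STy
    ωˢ    : STy

  data KTy : Set where
    _⊗_  : VTy → STy → KTy
    _∧ᶜ_ : KTy → KTy → KTy
    ωᶜ   : KTy

  data CfgTy : Set where
    _⇒ᵗ_ : STy → KTy → CfgTy
    _∧ᵗ_ : CfgTy → CfgTy → CfgTy
    ωᵗ   : CfgTy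

_∈domᵀ_ : Loc → STy → Set
ℓ ∈domᵀ ⟨ ℓ' ∶ δ ⟩ = ℓ ≡ ℓ'
ℓ ∈domᵀ (σ ∧ˢ σ')  = (ℓ ∈domᵀ σ) ⊎ (ℓ ∈domᵀ σ')
ℓ ∈domᵀ ωˢ         = ⊥

infix 4 _≤ᵈ_ _≤ˢ_ _≤ᶜ_ _≤ᵗ_

mutual
  data _≤ᵈ_ : VTy → VTy → Set where
    reflᵈ  : ∀ {a} → a ≤ᵈ a
    transᵈ : ∀ {a b c} → a ≤ᵈ b → b ≤ᵈ c → a ≤ᵈ c
    topᵈ   : ∀ {a} → a ≤ᵈ ωᵈ
    lbᵈ₁   : ∀ {a b} → a ∧ᵈ b ≤ᵈ a
    lbᵈ₂   : ∀ {a b} → a ∧ᵈ b ≤ᵈ b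
    dupᵈ   : ∀ {a} → a ≤ᵈ a ∧ᵈ a
    monᵈ   : ∀ {a a' b b'} → a ≤ᵈ a' → b ≤ᵈ b' → a ∧ᵈ b ≤ᵈ a' ∧ᵈ b'
    ω-arrᵈ : ωᵈ ≤ᵈ ωᵈ ⇒ᵈ ωᵗ
    ∧-arrᵈ : ∀ {δ τ τ'} → (δ ⇒ᵈ τ) ∧ᵈ (δ ⇒ᵈ τ') ≤ᵈ δ ⇒ᵈ (τ ∧ᵗ τ')
    arrᵈ   : ∀ {δ δ' τ τ'} → δ' ≤ᵈ δ → τ ≤ᵗ τ' → δ ⇒ᵈ τ ≤ᵈ δ' ⇒ᵈ τ'

  data _≤ˢ_ : STy → STy → Set where
    reflˢ  : ∀ {a} → a ≤ˢ a
    transˢ : ∀ {a b c} → a ≤ˢ b → b ≤ˢ c → a ≤ˢ c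
    topˢ   : ∀ {a} → a ≤ˢ ωˢ
    lbˢ₁   : ∀ {a b} → a ∧ˢ b ≤ˢ a
    lbˢ₂   : ∀ {a b} → a ∧ˢ b ≤ˢ b
    dupˢ   : ∀ {a} → a ≤ˢ a ∧ˢ a
    monˢ   : ∀ {a a' b b'} → a ≤ˢ a' → b ≤ˢ b' → a ∧ˢ b ≤ˢ a' ∧ˢ b'
    ∧-locˢ : ∀ {ℓ δ δ'} → ⟨ ℓ ∶ δ ⟩ ∧ˢ ⟨ ℓ ∶ δ' ⟩ ≤ˢ ⟨ ℓ ∶ δ ∧ᵈ δ' ⟩
    locˢ   : ∀ {ℓ δ δ'} → δ ≤ᵈ δ' → ⟨ ℓ ∶ δ ⟩ ≤ˢ ⟨ ℓ ∶ δ' ⟩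

  data _≤ᶜ_ : KTy → KTy → Set where
    reflᶜ  : ∀ {a} → a ≤ᶜ a
    transᶜ : ∀ {a b c} → a ≤ᶜ b → b ≤ᶜ c → a ≤ᶜ c
    topᶜ   : ∀ {a} → a ≤ᶜ ωᶜ
    lbᶜ₁   : ∀ {a b} → a ∧ᶜ b ≤ᶜ a
    lbᶜ₂   : ∀ {a b} → a ∧ᶜ b ≤ᶜ b
    dupᶜ   : ∀ {a} → a ≤ᶜ a ∧ᶜ a
    monᶜ   : ∀ {a a' b b'} → a ≤ᶜ a' → b ≤ᶜ b' → a ∧ᶜ b ≤ᶜ a' ∧ᶜ b'
    ω-prodᶜ : ωᶜ ≤ᶜ ωᵈ ⊗ ωˢ
    ∧-prodᶜ : ∀ {δ δ' σ σ'} → (δ ⊗ σ) ∧ᶜ (δ' ⊗ σ') ≤ᶜ (δ ∧ᵈ δ') ⊗ (σ ∧ˢ σ')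
    prodᶜ  : ∀ {δ δ' σ σ'} → δ ≤ᵈ δ' → σ ≤ˢ σ' → δ ⊗ σ ≤ᶜ δ' ⊗ σ'

  data _≤ᵗ_ : CfgTy → CfgTy → Set where
    reflᵗ  : ∀ {a} → a ≤ᵗ a
    transᵗ : ∀ {a b c} → a ≤ᵗ b → b ≤ᵗ c → a ≤ᵗ c
    topᵗ   : ∀ {a} → a ≤ᵗ ωᵗ
    lbᵗ₁   : ∀ {a b} → a ∧ᵗ b ≤ᵗ a
    lbᵗ₂   : ∀ {a b} → a ∧ᵗ b ≤ᵗ b
    dupᵗ   : ∀ {a} → a ≤ᵗ a ∧ᵗ a
    monᵗ   : ∀ {a a' b b'} → a ≤ᵗ a' → b ≤ᵗ b' → a ∧ᵗ b ≤ᵗ a' ∧ᵗ b'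
    ω-arrᵗ : ωᵗ ≤ᵗ ωˢ ⇒ᵗ ωᶜ
    ∧-arrᵗ : ∀ {σ κ κ'} → (σ ⇒ᵗ κ) ∧ᵗ (σ ⇒ᵗ κ') ≤ᵗ σ ⇒ᵗ (κ ∧ᶜ κ')
    arrᵗ   : ∀ {σ σ' κ κ'} → σ' ≤ˢ σ → κ ≤ᶜ κ' → σ ⇒ᵗ κ ≤ᵗ σ' ⇒ᵗ κ'

Ctx : Set
Ctx = List VTy

data _∋_∶_ : Ctx → ℕ → VTy → Set where
  here  : ∀ {Γ δ} → (δ ∷ Γ) ∋ 0 ∶ δ
  there : ∀ {Γ δ δ' n} → Γ ∋ n ∶ δ → (δ' ∷ Γ) ∋ ℕ.suc n ∶ δ

infix 4 _⊢ᵛ_∶_ _⊢ᶜ_∶_ _⊢ˢ_∶_ _⊢ˡ_∶_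

mutual
  data _⊢ᵛ_∶_ : Ctx → Val → VTy → Set where
    ωᵛ   : ∀ {Γ V} → Γ ⊢ᵛ V ∶ ωᵈ
    ∧ᵛ   : ∀ {Γ V δ δ'} → Γ ⊢ᵛ V ∶ δ → Γ ⊢ᵛ V ∶ δ' → Γ ⊢ᵛ V ∶ δ ∧ᵈ δ'
    subᵛ : ∀ {Γ V δ δ'} → Γ ⊢ᵛ V ∶ δ → δ ≤ᵈ δ' → Γ ⊢ᵛ V ∶ δ'
    varᵛ : ∀ {Γ n δ} → Γ ∋ n ∶ δ → Γ ⊢ᵛ var n ∶ δ
    lamᵛ : ∀ {Γ M δ τ} → (δ ∷ Γ) ⊢ᶜ M ∶ τ → Γ ⊢ᵛ lam M ∶ δ ⇒ᵈ τ

  data _⊢ᶜ_∶_ : Ctx → Comp → CfgTy → Set where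
    ωᶜᵗ  : ∀ {Γ M} → Γ ⊢ᶜ M ∶ ωᵗ
    ∧ᶜᵗ  : ∀ {Γ M τ τ'} → Γ ⊢ᶜ M ∶ τ → Γ ⊢ᶜ M ∶ τ' → Γ ⊢ᶜ M ∶ τ ∧ᵗ τ'
    subᶜ : ∀ {Γ M τ τ'} → Γ ⊢ᶜ M ∶ τ → τ ≤ᵗ τ' → Γ ⊢ᶜ M ∶ τ'
    retᶜ : ∀ {Γ V δ σ} → Γ ⊢ᵛ V ∶ δ → Γ ⊢ᶜ ret V ∶ σ ⇒ᵗ (δ ⊗ σ)
    bindᶜ : ∀ {Γ M V σ δ' σ' δ'' σ''} →
      Γ ⊢ᶜ M ∶ σ ⇒ᵗ (δ' ⊗ σ') →
      Γ ⊢ᵛ V ∶ δ' ⇒ᵈ (σ' ⇒ᵗ (δ'' ⊗ σ'')) →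
      Γ ⊢ᶜ bind M V ∶ σ ⇒ᵗ (δ'' ⊗ σ'')
    getᶜ : ∀ {Γ ℓ M δ σ κ} → (δ ∷ Γ) ⊢ᶜ M ∶ σ ⇒ᵗ κ →
      Γ ⊢ᶜ get ℓ M ∶ (⟨ ℓ ∶ δ ⟩ ∧ˢ σ) ⇒ᵗ κ
    setᶜ : ∀ {Γ ℓ V M δ σ κ} → Γ ⊢ᵛ V ∶ δ →
      Γ ⊢ᶜ M ∶ (⟨ ℓ ∶ δ ⟩ ∧ˢ σ) ⇒ᵗ κ → ¬ (ℓ ∈domᵀ σ) →
      Γ ⊢ᶜ set ℓ V M ∶ σ ⇒ᵗ κ

mutual
  data _⊢ˢ_∶_ : Ctx → Store → STy → Set where
    ωˢᵗ  : ∀ {Γ s} → Γ ⊢ˢ s ∶ ωˢ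
    ∧ˢᵗ  : ∀ {Γ s σ σ'} → Γ ⊢ˢ s ∶ σ → Γ ⊢ˢ s ∶ σ' → Γ ⊢ˢ s ∶ σ ∧ˢ σ'
    subˢ : ∀ {Γ s σ σ'} → Γ ⊢ˢ s ∶ σ → σ ≤ˢ σ' → Γ ⊢ˢ s ∶ σ'
    upd-here  : ∀ {Γ ℓ u s δ} → Γ ⊢ˡ u ∶ δ → Γ ⊢ˢ upd ℓ u s ∶ ⟨ ℓ ∶ δ ⟩
    upd-there : ∀ {Γ ℓ ℓ' u s δ} → Γ ⊢ˢ s ∶ ⟨ ℓ' ∶ δ ⟩ → ℓ ≢ ℓ' →
      Γ ⊢ˢ upd ℓ u s ∶ ⟨ ℓ' ∶ δ ⟩

  data _⊢ˡ_∶_ : Ctx → Lookup → VTy → Set where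
    ωˡ   : ∀ {Γ u} → Γ ⊢ˡ u ∶ ωᵈ
    ∧ˡ   : ∀ {Γ u δ δ'} → Γ ⊢ˡ u ∶ δ → Γ ⊢ˡ u ∶ δ' → Γ ⊢ˡ u ∶ δ ∧ᵈ δ'
    subˡ : ∀ {Γ u δ δ'} → Γ ⊢ˡ u ∶ δ → δ ≤ᵈ δ' → Γ ⊢ˡ u ∶ δ'
    valˡ : ∀ {Γ V δ} → Γ ⊢ᵛ V ∶ δ → Γ ⊢ˡ val V ∶ δ
    lkpˡ : ∀ {Γ ℓ s δ} (p : ℓ ∈dom s) → Γ ⊢ˢ s ∶ ⟨ ℓ ∶ δ ⟩ → Γ ⊢ˡ lkp ℓ s p ∶ δ

{-# OPTIONS --safe #-}
-- A store s has type ⟨ ℓ ∶ δ ⟩ exactly when the first update of ℓ in s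
-- carries a lookup term of type δ, and every store typing is assembled from
-- such atomic typings. So it suffices that each store equation preserves,
-- location by location, the types of the binding, and each lookup equation
-- the types of the lookup term; the types of lkp ℓ s are exactly those of
-- the binding of ℓ in s, which ties the two inductions together.
module Submission where

open import Defs
open import Level using (0ℓ)
open import Data.Nat using (_≟_)
open import Data.Product using (_×_; _,_)
open import Data.Sum using (_⊎_; inj₁; inj₂)
open import Data.Unit using (⊤; tt)
open import Data.Empty using (⊥; ⊥-elim)
open import Function.Base using (_∘_)
open import Function.Bundles using (_⇔_; mk⇔; module Equivalence)
open import Function.Properties.Equivalence using (⇔-isEquivalence)
open import Relation.Binary.Structures using (IsEquivalence)
open import Relation.Nullary using (yes; no)
open import Relation.Binary.PropositionalEquality using (_≡_; _≢_; refl; sym)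

open Equivalence using (to; from)
open IsEquivalence (⇔-isEquivalence {ℓ = 0ℓ})
  using () renaming (refl to ⇔-refl; sym to ⇔-sym; trans to infixr 4 _⨾_)

private
  variable
    ℓ ℓ' ℓ₀ : Loc
    δ δ' : VTy
    σ σ' : STy
    s t : Store
    u u' : Lookup

module _ (Γ : Ctx) where

  Binds : Store → Loc → VTy → Set
  Binds emp          ℓ δ = ⊥
  Binds (upd ℓ' u s) ℓ δ = (ℓ ≡ ℓ' × Γ ⊢ˡ u ∶ δ) ⊎ (ℓ ≢ ℓ' × Binds s ℓ δ)

  binds-∧ : Binds s ℓ δ → Binds s ℓ δ' → Binds s ℓ (δ ∧ᵈ δ')
  binds-∧ {upd _ _ _} (inj₁ (eq , h)) (inj₁ (_ , h'))  = inj₁ (eq , ∧ˡ h h')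
  binds-∧ {upd _ _ _} (inj₁ (eq , _)) (inj₂ (ne , _))  = ⊥-elim (ne eq)
  binds-∧ {upd _ _ _} (inj₂ (ne , _)) (inj₁ (eq , _))  = ⊥-elim (ne eq)
  binds-∧ {upd _ _ _} (inj₂ (ne , b)) (inj₂ (_ , b'))  = inj₂ (ne , binds-∧ b b')

  binds-≤ : δ ≤ᵈ δ' → Binds s ℓ δ → Binds s ℓ δ'
  binds-≤ {s = upd _ _ _} le (inj₁ (eq , h)) = inj₁ (eq , subˡ h le)
  binds-≤ {s = upd _ _ _} le (inj₂ (ne , b)) = inj₂ (ne , binds-≤ le b)

  binds⇒⊢ˢ : Binds s ℓ δ → Γ ⊢ˢ s ∶ ⟨ ℓ ∶ δ ⟩
  binds⇒⊢ˢ {upd _ _ _} (inj₁ (refl , h)) = upd-here h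
  binds⇒⊢ˢ {upd _ _ _} (inj₂ (ne , b))   = upd-there (binds⇒⊢ˢ b) (λ eq → ne (sym eq))

  _⊨ˢ_ : Store → STy → Set
  s ⊨ˢ ⟨ ℓ ∶ δ ⟩ = Binds s ℓ δ
  s ⊨ˢ (σ ∧ˢ σ') = s ⊨ˢ σ × s ⊨ˢ σ'
  s ⊨ˢ ωˢ        = ⊤

  ⊨ˢ-≤ : σ ≤ˢ σ' → s ⊨ˢ σ → s ⊨ˢ σ'
  ⊨ˢ-≤ reflˢ           m        = m
  ⊨ˢ-≤ (transˢ le le') m        = ⊨ˢ-≤ le' (⊨ˢ-≤ le m)
  ⊨ˢ-≤ topˢ            _        = tt
  ⊨ˢ-≤ lbˢ₁            (m , _)  = m
  ⊨ˢ-≤ lbˢ₂            (_ , m') = m'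
  ⊨ˢ-≤ dupˢ            m        = m , m
  ⊨ˢ-≤ (monˢ le le')   (m , m') = ⊨ˢ-≤ le m , ⊨ˢ-≤ le' m'
  ⊨ˢ-≤ ∧-locˢ          (b , b') = binds-∧ b b'
  ⊨ˢ-≤ (locˢ le)       b        = binds-≤ le b

  ⊢ˢ⇒⊨ˢ : Γ ⊢ˢ s ∶ σ → s ⊨ˢ σ
  ⊢ˢ⇒⊨ˢ ωˢᵗ              = tt
  ⊢ˢ⇒⊨ˢ (∧ˢᵗ d d')       = ⊢ˢ⇒⊨ˢ d , ⊢ˢ⇒⊨ˢ d'
  ⊢ˢ⇒⊨ˢ (subˢ d le)      = ⊨ˢ-≤ le (⊢ˢ⇒⊨ˢ d)
  ⊢ˢ⇒⊨ˢ (upd-here h)     = inj₁ (refl , h)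
  ⊢ˢ⇒⊨ˢ (upd-there d ne) = inj₂ ((λ eq → ne (sym eq)) , ⊢ˢ⇒⊨ˢ d)

  ⊢ˢ⟨⟩⇔binds : Γ ⊢ˢ s ∶ ⟨ ℓ ∶ δ ⟩ ⇔ Binds s ℓ δ
  ⊢ˢ⟨⟩⇔binds = mk⇔ ⊢ˢ⇒⊨ˢ binds⇒⊢ˢ

  binds-upd-here : Binds (upd ℓ u s) ℓ δ ⇔ Γ ⊢ˡ u ∶ δ
  binds-upd-here = mk⇔ (λ { (inj₁ (_ , h)) → h ; (inj₂ (ne , _)) → ⊥-elim (ne refl) })
                       (λ h → inj₁ (refl , h))

  binds-upd-there : ℓ₀ ≢ ℓ → Binds (upd ℓ u s) ℓ₀ δ ⇔ Binds s ℓ₀ δ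
  binds-upd-there ne = mk⇔ (λ { (inj₁ (eq , _)) → ⊥-elim (ne eq) ; (inj₂ (_ , b)) → b })
                           (λ b → inj₂ (ne , b))

  ∈dom⇒binds-ω : ℓ ∈dom s → Binds s ℓ ωᵈ
  ∈dom⇒binds-ω {ℓ} {upd ℓ' _ _} p with ℓ ≟ ℓ' | p
  ... | yes refl | _       = inj₁ (refl , ωˡ)
  ... | no ne    | inj₁ eq = ⊥-elim (ne eq)
  ... | no ne    | inj₂ q  = inj₂ (ne , ∈dom⇒binds-ω q)

  ⊢lkp⇔binds : (p : ℓ ∈dom s) → Γ ⊢ˡ lkp ℓ s p ∶ δ ⇔ Binds s ℓ δ
  ⊢lkp⇔binds p = mk⇔ ⊢lkp⇒binds (λ b → lkpˡ p (binds⇒⊢ˢ b))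
    where
    ⊢lkp⇒binds : Γ ⊢ˡ lkp _ _ p ∶ δ → Binds _ _ δ
    ⊢lkp⇒binds ωˡ          = ∈dom⇒binds-ω p
    ⊢lkp⇒binds (∧ˡ d d')   = binds-∧ (⊢lkp⇒binds d) (⊢lkp⇒binds d')
    ⊢lkp⇒binds (subˡ d le) = binds-≤ le (⊢lkp⇒binds d)
    ⊢lkp⇒binds (lkpˡ _ d)  = ⊢ˢ⇒⊨ˢ d

  ⊢ˢ-atomwise : (∀ {ℓ δ} → Γ ⊢ˢ s ∶ ⟨ ℓ ∶ δ ⟩ → Γ ⊢ˢ t ∶ ⟨ ℓ ∶ δ ⟩) →
                Γ ⊢ˢ s ∶ σ → Γ ⊢ˢ t ∶ σ
  ⊢ˢ-atomwise f ωˢᵗ               = ωˢᵗ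
  ⊢ˢ-atomwise f (∧ˢᵗ d d')        = ∧ˢᵗ (⊢ˢ-atomwise f d) (⊢ˢ-atomwise f d')
  ⊢ˢ-atomwise f (subˢ d le)       = subˢ (⊢ˢ-atomwise f d) le
  ⊢ˢ-atomwise f d@(upd-here _)    = f d
  ⊢ˢ-atomwise f d@(upd-there _ _) = f d

  SameBindings : Store → Store → Set
  SameBindings s t = ∀ ℓ δ → Binds s ℓ δ ⇔ Binds t ℓ δ

  SameTypes : Lookup → Lookup → Set
  SameTypes u u' = ∀ δ → Γ ⊢ˡ u ∶ δ ⇔ Γ ⊢ˡ u' ∶ δ

  binds-upd-cong : SameTypes u u' → SameBindings s t → SameBindings (upd ℓ u s) (upd ℓ u' t)
  binds-upd-cong {ℓ = ℓ} u≃u' s≃t ℓ₀ δ with ℓ₀ ≟ ℓ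
  ... | yes refl = binds-upd-here ⨾ u≃u' δ ⨾ ⇔-sym binds-upd-here
  ... | no ne    = binds-upd-there ne ⨾ s≃t ℓ₀ δ ⨾ ⇔-sym (binds-upd-there ne)

  binds-upd-lkp : (p : ℓ ∈dom s) → SameBindings (upd ℓ (lkp ℓ s p) s) s
  binds-upd-lkp {ℓ} p ℓ₀ δ with ℓ₀ ≟ ℓ
  ... | yes refl = binds-upd-here ⨾ ⊢lkp⇔binds p
  ... | no ne    = binds-upd-there ne

  binds-upd-upd : SameBindings (upd ℓ u (upd ℓ u' s)) (upd ℓ u s)
  binds-upd-upd {ℓ} ℓ₀ δ with ℓ₀ ≟ ℓ
  ... | yes refl = binds-upd-here ⨾ ⇔-sym binds-upd-here
  ... | no ne    = binds-upd-there ne ⨾ binds-upd-there ne ⨾ ⇔-sym (binds-upd-there ne)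

  binds-upd-comm : ℓ ≢ ℓ' → SameBindings (upd ℓ u (upd ℓ' u' s)) (upd ℓ' u' (upd ℓ u s))
  binds-upd-comm {ℓ} {ℓ'} ℓ≢ℓ' ℓ₀ δ with ℓ₀ ≟ ℓ | ℓ₀ ≟ ℓ'
  ... | yes refl | yes refl = ⊥-elim (ℓ≢ℓ' refl)
  ... | yes refl | no ne'   =
    binds-upd-here ⨾ ⇔-sym binds-upd-here ⨾ ⇔-sym (binds-upd-there ne')
  ... | no ne    | yes refl =
    binds-upd-there ne ⨾ binds-upd-here ⨾ ⇔-sym binds-upd-here
  ... | no ne    | no ne'   =
    binds-upd-there ne ⨾ binds-upd-there ne' ⨾ ⇔-sym (binds-upd-there ne) ⨾ ⇔-sym (binds-upd-there ne')

  mutual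
    ≈ˢ⇒sameBindings : s ≈ˢ t → SameBindings s t
    ≈ˢ⇒sameBindings reflˢ          ℓ δ = ⇔-refl
    ≈ˢ⇒sameBindings (symˢ e)       ℓ δ = ⇔-sym (≈ˢ⇒sameBindings e ℓ δ)
    ≈ˢ⇒sameBindings (transˢ e e')  ℓ δ = ≈ˢ⇒sameBindings e ℓ δ ⨾ ≈ˢ⇒sameBindings e' ℓ δ
    ≈ˢ⇒sameBindings (cong-upd e e')    = binds-upd-cong (≈ˡ⇒sameTypes e) (≈ˢ⇒sameBindings e')
    ≈ˢ⇒sameBindings (ax-upd-lkp p)     = binds-upd-lkp p
    ≈ˢ⇒sameBindings ax-upd-upd         = binds-upd-upd
    ≈ˢ⇒sameBindings (ax-upd-comm ne)   = binds-upd-comm ne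

    ≈ˡ⇒sameTypes : u ≈ˡ u' → SameTypes u u'
    ≈ˡ⇒sameTypes reflˡ                δ = ⇔-refl
    ≈ˡ⇒sameTypes (symˡ e)             δ = ⇔-sym (≈ˡ⇒sameTypes e δ)
    ≈ˡ⇒sameTypes (transˡ e e')        δ = ≈ˡ⇒sameTypes e δ ⨾ ≈ˡ⇒sameTypes e' δ
    ≈ˡ⇒sameTypes (cong-lkp p p' e)    δ =
      ⊢lkp⇔binds p ⨾ ≈ˢ⇒sameBindings e _ δ ⨾ ⇔-sym (⊢lkp⇔binds p')
    ≈ˡ⇒sameTypes (ax-lkp-upd p)       δ = ⊢lkp⇔binds p ⨾ binds-upd-here
    ≈ˡ⇒sameTypes (ax-lkp-upd' ne p q) δ =
      ⊢lkp⇔binds p ⨾ binds-upd-there ne ⨾ ⇔-sym (⊢lkp⇔binds q)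

mainTheorem15 : (Γ : Ctx) (s t : Store) (σ : STy) → Γ ⊢ˢ s ∶ σ → s ≈ˢ t → Γ ⊢ˢ t ∶ σ
mainTheorem15 Γ s t σ d s≈t = ⊢ˢ-atomwise Γ preservesAtoms d
  where
  preservesAtoms : ∀ {ℓ δ} → Γ ⊢ˢ s ∶ ⟨ ℓ ∶ δ ⟩ → Γ ⊢ˢ t ∶ ⟨ ℓ ∶ δ ⟩
  preservesAtoms {ℓ} {δ} =
    from (⊢ˢ⟨⟩⇔binds Γ) ∘ to (≈ˢ⇒sameBindings Γ s≈t ℓ δ) ∘ to (⊢ˢ⟨⟩⇔binds Γ)
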